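{- For $i=1,2$, let $G_i$ be bipartite graphs with parts $A_i$ and $B_i$, where $|A_1|=|A_2|=n_1$ and $|B_1|=|B_2|=n_2$, and $G_1,G_2$ are edge-disjoint. Suppose $A_1\cup A_2$ and $B_1\cup B_2$ are disjoint (while $A_1$ may intersect $A_2$ and $B_1$ may intersect $B_2$). Then $\mathrm{ISO}(G_1,G_2)\ge \frac{|E(G_1)|\,|E(G_2)|}{n_1n_2}$.
   Context: For two edge-disjoint graphs $G_1,G_2$ on (possibly overlapping) vertex sets $V_1,V_2$ with $|V_1|=|V_2|$, the similarity $\mathrm{ISO}(G_1,G_2)$ is the maximum integer $s$ such that there is a bijection $f:V_1\to V_2$ for which $f(G_1)\cap G_2$ has $s$ edges. Here, for a bijection $f:V\to V'$, $f(G)$ is the graph on $V'$ whose edges are $\{f(x)f(y): xy\in E(G)\}$, and $H_1\cap H_2$ denotes the graph whose edge set is the intersection of the edge sets. -}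

module Defs where

open import Data.Nat using (ℕ; _+_; _*_; _≤_)
open import Data.Bool using (Bool; true; false; _∧_)
open import Data.Fin using (Fin)
open import Data.Fin.Subset using (Subset; _∈_; _∉_; _∪_; ∣_∣)
open import Data.Vec using (lookup)
open import Data.Vec.Functional using (foldr)
open import Data.Product using (_×_; Σ; ∃)
open import Data.Sum using (_⊎_)
open import Data.Empty using (⊥)
open import Relation.Nullary using (¬_)
open import Relation.Binary.PropositionalEquality using (_≡_)

sumFin : ∀ {n} → (Fin n → ℕ) → ℕ
sumFin {n} f = foldr _+_ 0 f

[_] : Bool → ℕ
[ true ] = 1
[ false ] = 0

DisjointSub : ∀ {N} → Subset N → Subset N → Set
DisjointSub S T = ∀ x → x ∈ S → x ∉ T

Graph : ℕ → Set
Graph N = Fin N → Fin N → Bool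

Symmetric : ∀ {N} → Graph N → Set
Symmetric G = ∀ x y → G x y ≡ G y x

-- G is a bipartite graph with parts A and B (disjoint), so its vertex set is A ∪ B
-- and every edge joins A and B.
IsBipartite : ∀ {N} → Graph N → Subset N → Subset N → Set
IsBipartite G A B =
  Symmetric G × DisjointSub A B ×
  (∀ x y → G x y ≡ true → (x ∈ A × y ∈ B) ⊎ (x ∈ B × y ∈ A))

-- Number of edges of a bipartite graph G with parts A, B: each edge has exactly one
-- endpoint in A and one in B, so edges correspond to pairs (a , b) ∈ A × B adjacent in G.
edgeCount : ∀ {N} → Graph N → Subset N → Subset N → ℕ
edgeCount G A B =
  sumFin (λ x → sumFin (λ y → [ lookup A x ∧ (lookup B y ∧ G x y) ]))

EdgeDisjoint : ∀ {N} → Graph N → Graph N → Set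
EdgeDisjoint G H = ∀ x y → ¬ (G x y ≡ true × H x y ≡ true)

BijectionOn : ∀ {N} → (Fin N → Fin N) → Subset N → Subset N → Set
BijectionOn f V W =
  (∀ x → x ∈ V → f x ∈ W) ×
  (∀ x y → x ∈ V → y ∈ V → f x ≡ f y → x ≡ y) ×
  (∀ z → z ∈ W → Σ (Fin _) λ x → x ∈ V × f x ≡ z)

-- Number of edges of f(G1) ∩ G2, where G1 is bipartite with parts A1, B1:
-- edges xy of G1 (oriented x ∈ A1, y ∈ B1) with f x f y an edge of G2.
commonEdges : ∀ {N} → (Fin N → Fin N) → Graph N → Subset N → Subset N → Graph N → ℕ
commonEdges f G1 A1 B1 G2 =
  sumFin (λ x → sumFin (λ y →
    [ lookup A1 x ∧ (lookup B1 y ∧ (G1 x y ∧ G2 (f x) (f y))) ]))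

-- "ISO(G1,G2) ≥ num/den" with denominators cleared: since ISO is a maximum over the
-- (finitely many) bijections f : V1 → V2, this says some bijection f satisfies
-- num ≤ den * |E(f(G1) ∩ G2)|.
ISO≥ : ∀ {N} → Graph N → Subset N → Subset N → Graph N → Subset N → Subset N → ℕ → ℕ → Set
ISO≥ G1 A1 B1 G2 A2 B2 num den =
  ∃ λ f → BijectionOn f (A1 ∪ B1) (A2 ∪ B2) × num ≤ den * commonEdges f G1 A1 B1 G2

module Submission where

-- The argument averages over bijections, one side at a time.  The key general
-- fact is the ASSIGNMENT LEMMA: for two n-element sets P, Q and any weight
-- M : P × Q → ℕ some bijection σ : P → Q has  ∑∑ M ≤ n · ∑ₓ M x (σ x), i.e. does
-- at least as well as a uniformly random bijection.  It is proved by induction on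
-- n: fix a ∈ P, choose its image a' by a pigeonhole (averaging) argument, and
-- extend a bijection P ∖ a → Q ∖ a' obtained by induction.
--
-- Two rounds of it (lemma two-rounds) give τ : B₁ → B₂ with e₁e₂ ≤ n₂ ∑_b d₁(b) d₂(τ b)
-- (dᵢ = degree into Aᵢ) and then σ : A₁ → A₂ with ∑_b d₁(b) d₂(τ b) ≤ n₁ · #{ab ∈ G₁ :
-- σ(a)τ(b) ∈ G₂}.  Gluing σ and τ gives the required bijection A₁ ∪ B₁ → A₂ ∪ B₂.

open import Defs
open import Data.Nat using (ℕ; zero; suc; _+_; _*_; _≤_; _<_; z≤n; s≤s)
open import Data.Nat.Properties hiding (_≟_)
open import Data.Bool using (Bool; true; false; _∧_; _∨_; not; if_then_else_)
open import Data.Bool.Properties using (∧-identityʳ; ∨-zeroʳ)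
import Data.Bool.Properties as Bool
open import Data.Fin using (Fin; zero; suc; _≟_)
open import Data.Fin.Properties using (any?)
open import Data.Fin.Subset using (Subset; _∪_; ∣_∣; _∈_)
open import Data.Vec using ([]; _∷_; lookup)
open import Data.Vec.Properties using (lookup-zipWith; []=⇒lookup; lookup⇒[]=)
open import Data.Product using (∃; ∃₂; _×_; _,_; proj₁; proj₂)
open import Data.Sum using (_⊎_; inj₁; inj₂)
open import Data.Empty using (⊥-elim)
open import Relation.Nullary using (yes; no; does; _×-dec_)
open import Relation.Binary.PropositionalEquality hiding ([_])
open import Algebra.Properties.Semiring.Sum +-*-semiring
  using (sum-cong-≗; sum-replicate-zero; ∑-comm; ∑-distrib-+; *-distribˡ-sum)
open import Algebra.Properties.CommutativeSemigroup *-commutativeSemigroup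
  using (x∙yz≈y∙xz)

∑∈ : ∀ {N} → (Fin N → Bool) → (Fin N → ℕ) → ℕ
∑∈ P g = sumFin (λ x → [ P x ] * g x)

# : ∀ {N} → (Fin N → Bool) → ℕ
# P = ∑∈ P (λ _ → 1)

∑∈-cong : ∀ {N} (P : Fin N → Bool) {g h : Fin N → ℕ} →
  (∀ x → P x ≡ true → g x ≡ h x) → ∑∈ P g ≡ ∑∈ P h
∑∈-cong P {g} {h} g≡h = sum-cong-≗ term
  where
  term : ∀ x → [ P x ] * g x ≡ [ P x ] * h x
  term x with P x in Px
  ... | true  = cong (_+ 0) (g≡h x Px)
  ... | false = refl

sumFin-mono : ∀ {N} {g h : Fin N → ℕ} → (∀ x → g x ≤ h x) → sumFin g ≤ sumFin h
sumFin-mono {zero}  g≤h = z≤n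
sumFin-mono {suc N} g≤h = +-mono-≤ (g≤h zero) (sumFin-mono (λ x → g≤h (suc x)))

∑∈-mono : ∀ {N} (P : Fin N → Bool) {g h : Fin N → ℕ} →
  (∀ x → P x ≡ true → g x ≤ h x) → ∑∈ P g ≤ ∑∈ P h
∑∈-mono P {g} {h} g≤h = sumFin-mono term
  where
  term : ∀ x → [ P x ] * g x ≤ [ P x ] * h x
  term x with P x in Px
  ... | true  = +-monoˡ-≤ 0 (g≤h x Px)
  ... | false = z≤n

∑∈-+ : ∀ {N} (P : Fin N → Bool) (g h : Fin N → ℕ) →
  ∑∈ P (λ x → g x + h x) ≡ ∑∈ P g + ∑∈ P h
∑∈-+ P g h = trans (sum-cong-≗ (λ x → *-distribˡ-+ [ P x ] (g x) (h x)))
                   (∑-distrib-+ (λ x → [ P x ] * g x) (λ x → [ P x ] * h x))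

∑∈-*ˡ : ∀ {N} (P : Fin N → Bool) (c : ℕ) (g : Fin N → ℕ) →
  ∑∈ P (λ x → c * g x) ≡ c * ∑∈ P g
∑∈-*ˡ P c g = trans (sum-cong-≗ (λ x → x∙yz≈y∙xz [ P x ] c (g x)))
                    (sym (*-distribˡ-sum c (λ x → [ P x ] * g x)))

∑∈-comm : ∀ {N} (P Q : Fin N → Bool) (h : Fin N → Fin N → ℕ) →
  ∑∈ P (λ x → ∑∈ Q (h x)) ≡ ∑∈ Q (λ y → ∑∈ P (λ x → h x y))
∑∈-comm P Q h = begin
  ∑∈ P (λ x → ∑∈ Q (h x))
    ≡⟨ sum-cong-≗ (λ x → *-distribˡ-sum [ P x ] (λ y → [ Q y ] * h x y)) ⟩
  sumFin (λ x → sumFin (λ y → [ P x ] * ([ Q y ] * h x y)))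
    ≡⟨ ∑-comm (λ x y → [ P x ] * ([ Q y ] * h x y)) ⟩
  sumFin (λ y → sumFin (λ x → [ P x ] * ([ Q y ] * h x y)))
    ≡⟨ sum-cong-≗ (λ y → ∑∈-*ˡ P [ Q y ] (λ x → h x y)) ⟩
  ∑∈ Q (λ y → ∑∈ P (λ x → h x y)) ∎
  where open ≡-Reasoning

∑∈-product : ∀ {N} (P Q : Fin N → Bool) (g h : Fin N → ℕ) →
  ∑∈ P (λ x → ∑∈ Q (λ y → g x * h y)) ≡ ∑∈ P g * ∑∈ Q h
∑∈-product P Q g h = begin
  ∑∈ P (λ x → ∑∈ Q (λ y → g x * h y)) ≡⟨ ∑∈-cong P (λ x _ → ∑∈-*ˡ Q (g x) h) ⟩
  ∑∈ P (λ x → g x * ∑∈ Q h)           ≡⟨ ∑∈-cong P (λ x _ → *-comm (g x) (∑∈ Q h)) ⟩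
  ∑∈ P (λ x → ∑∈ Q h * g x)           ≡⟨ ∑∈-*ˡ P (∑∈ Q h) g ⟩
  ∑∈ Q h * ∑∈ P g                     ≡⟨ *-comm (∑∈ Q h) (∑∈ P g) ⟩
  ∑∈ P g * ∑∈ Q h                     ∎
  where open ≡-Reasoning

∑∈-const : ∀ {N} (P : Fin N → Bool) (c : ℕ) → ∑∈ P (λ _ → c) ≡ c * # P
∑∈-const P c = trans (∑∈-cong P (λ _ _ → sym (*-identityʳ c))) (∑∈-*ˡ P c (λ _ → 1))

_∖_ : ∀ {N} → (Fin N → Bool) → Fin N → (Fin N → Bool)
(P ∖ a) x = P x ∧ not (does (x ≟ a))

∖-intro : ∀ {N} (P : Fin N → Bool) {a x} → P x ≡ true → x ≢ a → (P ∖ a) x ≡ true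
∖-intro P {a} {x} Px x≢a with x ≟ a
... | yes x≡a = ⊥-elim (x≢a x≡a)
... | no _    = trans (∧-identityʳ _) Px

∖-elim : ∀ {N} (P : Fin N → Bool) {a x} → (P ∖ a) x ≡ true → P x ≡ true × x ≢ a
∖-elim P {a} {x} P∖ax with P x | x ≟ a
... | true | no x≢a = refl , x≢a

sumFin-point : ∀ {N} (a : Fin N) (v : ℕ) → sumFin (λ x → if does (x ≟ a) then v else 0) ≡ v
sumFin-point {suc N} zero    v = trans (cong (v +_) (sum-replicate-zero N)) (+-identityʳ v)
sumFin-point {suc N} (suc a) v = trans (sum-cong-≗ shift) (sumFin-point a v)
  where
  shift : ∀ x → (if does (suc x ≟ suc a) then v else 0) ≡ (if does (x ≟ a) then v else 0)
  shift x with x ≟ a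
  ... | yes refl = refl
  ... | no _     = refl

∑∈-remove : ∀ {N} (P : Fin N → Bool) {a} (g : Fin N → ℕ) → P a ≡ true →
  ∑∈ P g ≡ g a + ∑∈ (P ∖ a) g
∑∈-remove P {a} g Pa = begin
  ∑∈ P g                                               ≡⟨ sum-cong-≗ split ⟩
  sumFin (λ x → (if does (x ≟ a) then g a else 0) + [ (P ∖ a) x ] * g x)
    ≡⟨ ∑-distrib-+ (λ x → if does (x ≟ a) then g a else 0) (λ x → [ (P ∖ a) x ] * g x) ⟩
  sumFin (λ x → if does (x ≟ a) then g a else 0) + ∑∈ (P ∖ a) g
    ≡⟨ cong (_+ ∑∈ (P ∖ a) g) (sumFin-point a (g a)) ⟩
  g a + ∑∈ (P ∖ a) g                                   ∎
  where
  open ≡-Reasoning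
  split : ∀ x → [ P x ] * g x ≡ (if does (x ≟ a) then g a else 0) + [ (P ∖ a) x ] * g x
  split x with x ≟ a
  ... | yes refl rewrite Pa = refl
  ... | no _     rewrite ∧-identityʳ (P x) = refl

#-remove : ∀ {N} (P : Fin N → Bool) {a} → P a ≡ true → # P ≡ suc (# (P ∖ a))
#-remove P Pa = ∑∈-remove P (λ _ → 1) Pa

∑∈-vanish : ∀ {N} (P : Fin N → Bool) (g : Fin N → ℕ) → (∀ x → P x ≢ true) → ∑∈ P g ≡ 0
∑∈-vanish {N} P g ∉P = trans (sum-cong-≗ term) (sum-replicate-zero N)
  where
  term : ∀ x → [ P x ] * g x ≡ 0
  term x with P x in Px
  ... | true  = ⊥-elim (∉P x Px)
  ... | false = refl

#≡0⇒∉ : ∀ {N} (P : Fin N → Bool) → # P ≡ 0 → ∀ x → P x ≢ true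
#≡0⇒∉ P #P≡0 x Px with () ← trans (sym (#-remove P Px)) #P≡0

∑∈-empty : ∀ {N} (P : Fin N → Bool) (g : Fin N → ℕ) → # P ≡ 0 → ∑∈ P g ≡ 0
∑∈-empty P g #P≡0 = ∑∈-vanish P g (#≡0⇒∉ P #P≡0)

#≡suc⇒∈ : ∀ {N} (P : Fin N → Bool) {m} → # P ≡ suc m → ∃ λ a → P a ≡ true
#≡suc⇒∈ P #P≡suc with any? (λ x → P x Bool.≟ true)
... | yes found = found
... | no  none  with () ← trans (sym #P≡suc) (∑∈-vanish P (λ _ → 1) (λ x Px → none (x , Px)))

∑∈-removals : ∀ {N} (Q : Fin N → Bool) (g : Fin N → ℕ) {m} → # Q ≡ suc m →
  ∑∈ Q (λ a' → ∑∈ (Q ∖ a') g) ≡ m * ∑∈ Q g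
∑∈-removals Q g {m} #Q≡ = +-cancelʳ-≡ (∑∈ Q g) _ _ (begin
  ∑∈ Q (λ a' → ∑∈ (Q ∖ a') g) + ∑∈ Q g   ≡⟨ ∑∈-+ Q (λ a' → ∑∈ (Q ∖ a') g) g ⟨
  ∑∈ Q (λ a' → ∑∈ (Q ∖ a') g + g a')    ≡⟨ ∑∈-cong Q (λ a' Qa' →
                                              trans (+-comm _ (g a')) (sym (∑∈-remove Q g Qa'))) ⟩
  ∑∈ Q (λ _ → ∑∈ Q g)                   ≡⟨ ∑∈-const Q (∑∈ Q g) ⟩
  ∑∈ Q g * # Q                          ≡⟨ cong (∑∈ Q g *_) #Q≡ ⟩
  ∑∈ Q g * suc m                        ≡⟨ *-comm (∑∈ Q g) (suc m) ⟩
  ∑∈ Q g + m * ∑∈ Q g                   ≡⟨ +-comm (∑∈ Q g) _ ⟩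
  m * ∑∈ Q g + ∑∈ Q g                   ∎)
  where open ≡-Reasoning

average : ∀ {N} (Q : Fin N → Bool) (h : Fin N → ℕ) (c : ℕ) {m} → # Q ≡ suc m →
  c * # Q ≤ ∑∈ Q h → ∃ λ x → Q x ≡ true × c ≤ h x
average Q h c {m} #Q≡ c#Q≤ with any? (λ x → (Q x Bool.≟ true) ×-dec (c ≤? h x))
... | yes found = found
... | no  none  = ⊥-elim (<⇒≱ total<c#Q c#Q≤)
  where
  open ≤-Reasoning
  total<c#Q : ∑∈ Q h < c * # Q
  total<c#Q = begin-strict
    ∑∈ Q h                       <⟨ s≤s (m≤n+m (∑∈ Q h) m) ⟩
    suc m + ∑∈ Q h               ≡⟨ cong (_+ ∑∈ Q h) #Q≡ ⟨
    # Q + ∑∈ Q h                 ≡⟨ ∑∈-+ Q (λ _ → 1) h ⟨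
    ∑∈ Q (λ x → suc (h x))       ≤⟨ ∑∈-mono Q (λ x Qx → ≰⇒> (λ c≤hx → none (x , Qx , c≤hx))) ⟩
    ∑∈ Q (λ _ → c)               ≡⟨ ∑∈-const Q c ⟩
    c * # Q                      ∎

record BijectiveOn {N} (σ : Fin N → Fin N) (P Q : Fin N → Bool) : Set where
  field
    maps       : ∀ {x} → P x ≡ true → Q (σ x) ≡ true
    injective  : ∀ {x y} → P x ≡ true → P y ≡ true → σ x ≡ σ y → x ≡ y
    surjective : ∀ {z} → Q z ≡ true → ∃ λ x → P x ≡ true × σ x ≡ z

empty-bijective : ∀ {N} {P Q : Fin N → Bool} (σ : Fin N → Fin N) →
  # P ≡ 0 → # Q ≡ 0 → BijectiveOn σ P Q
empty-bijective {P = P} {Q} σ #P≡0 #Q≡0 = record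
  { maps       = λ {x} Px → ⊥-elim (#≡0⇒∉ P #P≡0 x Px)
  ; injective  = λ {x} Px _ _ → ⊥-elim (#≡0⇒∉ P #P≡0 x Px)
  ; surjective = λ {z} Qz → ⊥-elim (#≡0⇒∉ Q #Q≡0 z Qz)
  }

_[_↦_] : ∀ {N} → (Fin N → Fin N) → Fin N → Fin N → (Fin N → Fin N)
(σ [ a ↦ a' ]) x with x ≟ a
... | yes _ = a'
... | no  _ = σ x

↦-here : ∀ {N} (σ : Fin N → Fin N) a a' → (σ [ a ↦ a' ]) a ≡ a'
↦-here σ a a' with a ≟ a
... | yes _   = refl
... | no  a≢a = ⊥-elim (a≢a refl)

↦-there : ∀ {N} (σ : Fin N → Fin N) {a a' x} → x ≢ a → (σ [ a ↦ a' ]) x ≡ σ x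
↦-there σ {a} {x = x} x≢a with x ≟ a
... | yes x≡a = ⊥-elim (x≢a x≡a)
... | no  _   = refl

extend-bijective : ∀ {N} {P Q : Fin N → Bool} {a a'} (σ : Fin N → Fin N) →
  P a ≡ true → Q a' ≡ true → BijectiveOn σ (P ∖ a) (Q ∖ a') →
  BijectiveOn (σ [ a ↦ a' ]) P Q
extend-bijective {P = P} {Q} {a} {a'} σ Pa Qa' σ-bij = record
  { maps = maps ; injective = injective ; surjective = surjective }
  where
  module σ = BijectiveOn σ-bij

  image≢a' : ∀ {x} → P x ≡ true → x ≢ a → σ x ≢ a'
  image≢a' Px x≢a = proj₂ (∖-elim Q (σ.maps (∖-intro P Px x≢a)))

  maps : ∀ {x} → P x ≡ true → Q ((σ [ a ↦ a' ]) x) ≡ true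
  maps {x} Px with x ≟ a
  ... | yes _   = Qa'
  ... | no  x≢a = proj₁ (∖-elim Q (σ.maps (∖-intro P Px x≢a)))

  injective : ∀ {x y} → P x ≡ true → P y ≡ true →
    (σ [ a ↦ a' ]) x ≡ (σ [ a ↦ a' ]) y → x ≡ y
  injective {x} {y} Px Py eq with x ≟ a | y ≟ a
  ... | yes x≡a | yes y≡a = trans x≡a (sym y≡a)
  ... | yes _   | no  y≢a = ⊥-elim (image≢a' Py y≢a (sym eq))
  ... | no  x≢a | yes _   = ⊥-elim (image≢a' Px x≢a eq)
  ... | no  x≢a | no  y≢a = σ.injective (∖-intro P Px x≢a) (∖-intro P Py y≢a) eq

  surjective : ∀ {z} → Q z ≡ true → ∃ λ x → P x ≡ true × (σ [ a ↦ a' ]) x ≡ z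
  surjective {z} Qz with z ≟ a'
  ... | yes refl = a , Pa , ↦-here σ a a'
  ... | no  z≢a' with σ.surjective (∖-intro Q Qz z≢a')
  ...   | x , P∖ax , σx≡z =
    x , proj₁ (∖-elim P P∖ax) , trans (↦-there σ (proj₂ (∖-elim P P∖ax))) σx≡z

extend-sum : ∀ {N} (P : Fin N → Bool) {a} a' (σ : Fin N → Fin N) (M : Fin N → Fin N → ℕ) →
  P a ≡ true →
  ∑∈ P (λ x → M x ((σ [ a ↦ a' ]) x)) ≡ M a a' + ∑∈ (P ∖ a) (λ x → M x (σ x))
extend-sum P {a} a' σ M Pa =
  trans (∑∈-remove P (λ x → M x ((σ [ a ↦ a' ]) x)) Pa)
        (cong₂ _+_ (cong (M a) (↦-here σ a a'))
                   (∑∈-cong (P ∖ a) (λ x P∖ax → cong (M x) (↦-there σ (proj₂ (∖-elim P P∖ax))))))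

-- The arithmetic behind one induction step: from m·t ≤ (m+1)(m·w + r) and r ≤ m·v
-- follows t ≤ (m+1)(w + v), cancelling m; for m = 0 the bound t ≤ w is supplied.
extension-bound : ∀ m {t w r v} → m * t ≤ suc m * (m * w + r) → r ≤ m * v →
  (m ≡ 0 → t ≤ w) → t ≤ suc m * (w + v)
extension-bound zero    {w = w} {v = v} _ _ t≤w =
  ≤-trans (t≤w refl) (≤-trans (m≤m+n w v) (m≤m+n (w + v) 0))
extension-bound (suc k) {t} {w} {r} {v} m*t≤ r≤ _ = *-cancelˡ-≤ m (begin
  m * t                        ≤⟨ m*t≤ ⟩
  suc m * (m * w + r)          ≤⟨ *-monoʳ-≤ (suc m) (+-monoʳ-≤ (m * w) r≤) ⟩
  suc m * (m * w + m * v)      ≡⟨ cong (suc m *_) (*-distribˡ-+ m w v) ⟨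
  suc m * (m * (w + v))        ≡⟨ x∙yz≈y∙xz (suc m) m (w + v) ⟩
  m * (suc m * (w + v))        ∎)
  where
  open ≤-Reasoning
  m = suc k

offWeight : ∀ {N} (P Q : Fin N → Bool) (M : Fin N → Fin N → ℕ) → Fin N → Fin N → ℕ
offWeight P Q M a a' = ∑∈ (P ∖ a) (λ x → ∑∈ (Q ∖ a') (M x))

-- Choosing the image of a ∈ P: some a' ∈ Q has a score at least the average m·total.
-- Indeed the scores sum to (m+1)·m·total over Q, because every column of Q is left
-- out of exactly one of the off-weights.
choose-image : ∀ {N} (P Q : Fin N → Bool) (M : Fin N → Fin N → ℕ) {a m} →
  P a ≡ true → # Q ≡ suc m →
  ∃ λ a' → Q a' ≡ true ×
    m * ∑∈ P (λ x → ∑∈ Q (M x)) ≤ suc m * (m * M a a' + offWeight P Q M a a')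
choose-image {N} P Q M {a} {m} Pa #Q≡ = average Q score (m * total) #Q≡ (≤-reflexive (sym score-sum))
  where
  open ≡-Reasoning
  total rowₐ others : ℕ
  total  = ∑∈ P (λ x → ∑∈ Q (M x))
  rowₐ   = ∑∈ Q (M a)
  others = ∑∈ (P ∖ a) (λ x → ∑∈ Q (M x))

  score : Fin N → ℕ
  score a' = suc m * (m * M a a' + offWeight P Q M a a')

  offWeight-sum : ∑∈ Q (offWeight P Q M a) ≡ m * others
  offWeight-sum = begin
    ∑∈ Q (offWeight P Q M a)                              ≡⟨ ∑∈-comm (P ∖ a) Q _ ⟨
    ∑∈ (P ∖ a) (λ x → ∑∈ Q (λ a' → ∑∈ (Q ∖ a') (M x)))   ≡⟨ ∑∈-cong (P ∖ a) (λ x _ → ∑∈-removals Q (M x) #Q≡) ⟩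
    ∑∈ (P ∖ a) (λ x → m * ∑∈ Q (M x))                     ≡⟨ ∑∈-*ˡ (P ∖ a) m _ ⟩
    m * others                                            ∎

  score-sum : ∑∈ Q score ≡ m * total * # Q
  score-sum = begin
    ∑∈ Q score                                        ≡⟨ ∑∈-*ˡ Q (suc m) _ ⟩
    suc m * ∑∈ Q (λ a' → m * M a a' + offWeight P Q M a a')
      ≡⟨ cong (suc m *_) (∑∈-+ Q _ (offWeight P Q M a)) ⟩
    suc m * (∑∈ Q (λ a' → m * M a a') + ∑∈ Q (offWeight P Q M a))
      ≡⟨ cong (suc m *_) (cong₂ _+_ (∑∈-*ˡ Q m (M a)) offWeight-sum) ⟩
    suc m * (m * rowₐ + m * others)                   ≡⟨ cong (suc m *_) (*-distribˡ-+ m rowₐ others) ⟨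
    suc m * (m * (rowₐ + others))                     ≡⟨ cong (λ t → suc m * (m * t)) (∑∈-remove P _ Pa) ⟨
    suc m * (m * total)                               ≡⟨ *-comm (suc m) (m * total) ⟩
    m * total * suc m                                 ≡⟨ cong (m * total *_) #Q≡ ⟨
    m * total * # Q                                   ∎

∑∈-singletons : ∀ {N} (P Q : Fin N → Bool) (M : Fin N → Fin N → ℕ) {a a'} →
  P a ≡ true → Q a' ≡ true → # (P ∖ a) ≡ 0 → # (Q ∖ a') ≡ 0 →
  ∑∈ P (λ x → ∑∈ Q (M x)) ≡ M a a'
∑∈-singletons P Q M {a} {a'} Pa Qa' #P∖a≡0 #Q∖a'≡0 = begin
  ∑∈ P (λ x → ∑∈ Q (M x))                        ≡⟨ ∑∈-remove P _ Pa ⟩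
  ∑∈ Q (M a) + ∑∈ (P ∖ a) (λ x → ∑∈ Q (M x))     ≡⟨ cong₂ _+_ (∑∈-remove Q (M a) Qa') (∑∈-empty (P ∖ a) _ #P∖a≡0) ⟩
  M a a' + ∑∈ (Q ∖ a') (M a) + 0                 ≡⟨ cong (λ t → M a a' + t + 0) (∑∈-empty (Q ∖ a') _ #Q∖a'≡0) ⟩
  M a a' + 0 + 0                                 ≡⟨ cong (_+ 0) (+-identityʳ (M a a')) ⟩
  M a a' + 0                                     ≡⟨ +-identityʳ (M a a') ⟩
  M a a'                                         ∎
  where open ≡-Reasoning

-- A bijection σ : P → Q collecting at least the average weight of M over all
-- bijections between n-element sets: ∑∑ M ≤ n · ∑ₓ M x (σ x).
Assignment : ∀ {N} → ℕ → (P Q : Fin N → Bool) → (Fin N → Fin N → ℕ) → Set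
Assignment n P Q M =
  ∃ λ σ → BijectiveOn σ P Q × ∑∈ P (λ x → ∑∈ Q (M x)) ≤ n * ∑∈ P (λ x → M x (σ x))

assignment : ∀ {N} n (P Q : Fin N → Bool) → # P ≡ n → # Q ≡ n → (M : Fin N → Fin N → ℕ) →
  Assignment n P Q M
assignment zero P Q #P≡0 #Q≡0 M =
  (λ x → x) , empty-bijective (λ x → x) #P≡0 #Q≡0 , ≤-reflexive (∑∈-empty P _ #P≡0)
assignment {N} (suc m) P Q #P≡ #Q≡ M =
  σ' [ a ↦ a' ] , extend-bijective σ' Pa Qa' σ'-bij , bound
  where
  open ≤-Reasoning
  a : Fin N
  a = proj₁ (#≡suc⇒∈ P #P≡)
  Pa : P a ≡ true
  Pa = proj₂ (#≡suc⇒∈ P #P≡)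
  #P∖a : # (P ∖ a) ≡ m
  #P∖a = suc-injective (trans (sym (#-remove P Pa)) #P≡)

  chosen : ∃ λ a' → Q a' ≡ true ×
    m * ∑∈ P (λ x → ∑∈ Q (M x)) ≤ suc m * (m * M a a' + offWeight P Q M a a')
  chosen = choose-image P Q M Pa #Q≡
  a' : Fin N
  a' = proj₁ chosen
  Qa' : Q a' ≡ true
  Qa' = proj₁ (proj₂ chosen)
  #Q∖a' : # (Q ∖ a') ≡ m
  #Q∖a' = suc-injective (trans (sym (#-remove Q Qa')) #Q≡)

  induction : Assignment m (P ∖ a) (Q ∖ a') M
  induction = assignment m (P ∖ a) (Q ∖ a') #P∖a #Q∖a' M
  σ' : Fin N → Fin N
  σ' = proj₁ induction
  σ'-bij : BijectiveOn σ' (P ∖ a) (Q ∖ a')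
  σ'-bij = proj₁ (proj₂ induction)

  bound : ∑∈ P (λ x → ∑∈ Q (M x)) ≤ suc m * ∑∈ P (λ x → M x ((σ' [ a ↦ a' ]) x))
  bound = begin
    ∑∈ P (λ x → ∑∈ Q (M x))
      ≤⟨ extension-bound m (proj₂ (proj₂ chosen)) (proj₂ (proj₂ induction)) (λ m≡0 →
           ≤-reflexive (∑∈-singletons P Q M Pa Qa' (trans #P∖a m≡0) (trans #Q∖a' m≡0))) ⟩
    suc m * (M a a' + ∑∈ (P ∖ a) (λ x → M x (σ' x)))
      ≡⟨ cong (suc m *_) (extend-sum P a' σ' M Pa) ⟨
    suc m * ∑∈ P (λ x → M x ((σ' [ a ↦ a' ]) x))  ∎

_∪ᵇ_ : ∀ {N} → (Fin N → Bool) → (Fin N → Bool) → (Fin N → Bool)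
(P ∪ᵇ Q) x = P x ∨ Q x

∪-introˡ : ∀ {N} (P Q : Fin N → Bool) {x} → P x ≡ true → (P ∪ᵇ Q) x ≡ true
∪-introˡ P Q Px rewrite Px = refl

∪-introʳ : ∀ {N} (P Q : Fin N → Bool) {x} → Q x ≡ true → (P ∪ᵇ Q) x ≡ true
∪-introʳ P Q {x} Qx rewrite Qx = ∨-zeroʳ (P x)

∪-elim : ∀ {N} (P Q : Fin N → Bool) {x} → (P ∪ᵇ Q) x ≡ true → P x ≡ true ⊎ Q x ≡ true
∪-elim P Q {x} P∪Qx with P x
... | true  = inj₁ refl
... | false = inj₂ P∪Qx

glue : ∀ {N} → (Fin N → Bool) → (Fin N → Fin N) → (Fin N → Fin N) → (Fin N → Fin N)
glue P σ τ x = if P x then σ x else τ x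

glue-left : ∀ {N} (P : Fin N → Bool) (σ τ : Fin N → Fin N) {x} → P x ≡ true → glue P σ τ x ≡ σ x
glue-left P σ τ {x} Px = cong (λ b → if b then σ x else τ x) Px

glue-right : ∀ {N} (P : Fin N → Bool) (σ τ : Fin N → Fin N) {x} → P x ≡ false → glue P σ τ x ≡ τ x
glue-right P σ τ {x} Px = cong (λ b → if b then σ x else τ x) Px

glue-bijective : ∀ {N} {P Q P' Q' : Fin N → Bool} {σ τ : Fin N → Fin N} →
  (∀ x → Q x ≡ true → P x ≡ false) → (∀ x → Q' x ≡ true → P' x ≡ false) →
  BijectiveOn σ P P' → BijectiveOn τ Q Q' → BijectiveOn (glue P σ τ) (P ∪ᵇ Q) (P' ∪ᵇ Q')
glue-bijective {P = P} {Q} {P'} {Q'} {σ} {τ} Q∩P≡∅ Q'∩P'≡∅ σ-bij τ-bij = record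
  { maps = maps ; injective = injective ; surjective = surjective }
  where
  module σ = BijectiveOn σ-bij
  module τ = BijectiveOn τ-bij
  f = glue P σ τ

  side : ∀ {x} → (P ∪ᵇ Q) x ≡ true → (P x ≡ true × f x ≡ σ x) ⊎ (Q x ≡ true × f x ≡ τ x)
  side {x} P∪Qx with ∪-elim P Q P∪Qx
  ... | inj₁ Px = inj₁ (Px , glue-left P σ τ Px)
  ... | inj₂ Qx = inj₂ (Qx , glue-right P σ τ (Q∩P≡∅ x Qx))

  apart : ∀ {x y} → P x ≡ true → Q y ≡ true → σ x ≢ τ y
  apart {x} {y} Px Qy σx≡τy
    with () ← trans (sym (σ.maps Px)) (trans (cong P' σx≡τy) (Q'∩P'≡∅ (τ y) (τ.maps Qy)))

  maps : ∀ {x} → (P ∪ᵇ Q) x ≡ true → (P' ∪ᵇ Q') (f x) ≡ true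
  maps P∪Qx with side P∪Qx
  ... | inj₁ (Px , fx≡σx) = subst (λ z → (P' ∪ᵇ Q') z ≡ true) (sym fx≡σx) (∪-introˡ P' Q' (σ.maps Px))
  ... | inj₂ (Qx , fx≡τx) = subst (λ z → (P' ∪ᵇ Q') z ≡ true) (sym fx≡τx) (∪-introʳ P' Q' (τ.maps Qx))

  injective : ∀ {x y} → (P ∪ᵇ Q) x ≡ true → (P ∪ᵇ Q) y ≡ true → f x ≡ f y → x ≡ y
  injective P∪Qx P∪Qy fx≡fy with side P∪Qx | side P∪Qy
  ... | inj₁ (Px , ex) | inj₁ (Py , ey) = σ.injective Px Py (trans (sym ex) (trans fx≡fy ey))
  ... | inj₁ (Px , ex) | inj₂ (Qy , ey) = ⊥-elim (apart Px Qy (trans (sym ex) (trans fx≡fy ey)))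
  ... | inj₂ (Qx , ex) | inj₁ (Py , ey) = ⊥-elim (apart Py Qx (trans (sym ey) (trans (sym fx≡fy) ex)))
  ... | inj₂ (Qx , ex) | inj₂ (Qy , ey) = τ.injective Qx Qy (trans (sym ex) (trans fx≡fy ey))

  surjective : ∀ {z} → (P' ∪ᵇ Q') z ≡ true → ∃ λ x → (P ∪ᵇ Q) x ≡ true × f x ≡ z
  surjective P'∪Q'z with ∪-elim P' Q' P'∪Q'z
  ... | inj₁ P'z with σ.surjective P'z
  ...   | x , Px , σx≡z = x , ∪-introˡ P Q Px , trans (glue-left P σ τ Px) σx≡z
  surjective P'∪Q'z | inj₂ Q'z with τ.surjective Q'z
  ...   | y , Qy , τy≡z = y , ∪-introʳ P Q Qy , trans (glue-right P σ τ (Q∩P≡∅ y Qy)) τy≡z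

#-lookup : ∀ {N n} (A : Subset N) → ∣ A ∣ ≡ n → # (lookup A) ≡ n
#-lookup A |A|≡n = trans (sym (count A)) |A|≡n
  where
  count : ∀ {N} (A : Subset N) → ∣ A ∣ ≡ # (lookup A)
  count []          = refl
  count (true  ∷ A) = cong suc (count A)
  count (false ∷ A) = count A

disjoint-lookup : ∀ {N} {A B : Subset N} → DisjointSub A B →
  ∀ x → lookup B x ≡ true → lookup A x ≡ false
disjoint-lookup {A = A} {B} A∩B≡∅ x Bx with lookup A x in Ax
... | true  = ⊥-elim (A∩B≡∅ x (lookup⇒[]= x A Ax) (lookup⇒[]= x B Bx))
... | false = refl

lookup-∪ : ∀ {N} (A B : Subset N) x → lookup (A ∪ B) x ≡ (lookup A ∪ᵇ lookup B) x
lookup-∪ A B x = lookup-zipWith _∨_ x A B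

bijectionOn : ∀ {N} {f : Fin N → Fin N} {V W : Subset N} {P Q : Fin N → Bool} →
  (∀ x → lookup V x ≡ P x) → (∀ x → lookup W x ≡ Q x) →
  BijectiveOn f P Q → BijectionOn f V W
bijectionOn {f = f} {V} {W} {P} {Q} V≡P W≡Q f-bij =
  (λ x x∈V → to∈ W Q W≡Q (maps (from∈ P V≡P x∈V))) ,
  (λ x y x∈V y∈V → injective (from∈ P V≡P x∈V) (from∈ P V≡P y∈V)) ,
  (λ z z∈W → let (x , Px , fx≡z) = surjective (from∈ Q W≡Q z∈W) in x , to∈ V P V≡P Px , fx≡z)
  where
  open BijectiveOn f-bij
  from∈ : ∀ {U} R {x} → (∀ y → lookup U y ≡ R y) → x ∈ U → R x ≡ true
  from∈ R {x} U≡R x∈U = trans (sym (U≡R x)) ([]=⇒lookup x∈U)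
  to∈ : ∀ U R {x} → (∀ y → lookup U y ≡ R y) → R x ≡ true → x ∈ U
  to∈ U R {x} U≡R Rx = lookup⇒[]= x U (trans (U≡R x) Rx)

[∧] : ∀ p q → [ p ∧ q ] ≡ [ p ] * [ q ]
[∧] true  q = sym (+-identityʳ [ q ])
[∧] false q = refl

pair-count : ∀ {N} (P Q : Fin N → Bool) (H : Fin N → Fin N → Bool) →
  sumFin (λ x → sumFin (λ y → [ P x ∧ (Q y ∧ H x y) ])) ≡ ∑∈ P (λ x → ∑∈ Q (λ y → [ H x y ]))
pair-count P Q H = sum-cong-≗ λ x →
  trans (sum-cong-≗ (λ y → trans ([∧] (P x) _) (cong ([ P x ] *_) ([∧] (Q y) (H x y)))))
        (sym (*-distribˡ-sum [ P x ] (λ y → [ Q y ] * [ H x y ])))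

degree : ∀ {N} → Graph N → (Fin N → Bool) → Fin N → ℕ
degree G A b = ∑∈ A (λ a → [ G a b ])

edgeCount-degrees : ∀ {N} (G : Graph N) (A B : Subset N) →
  edgeCount G A B ≡ ∑∈ (lookup B) (degree G (lookup A))
edgeCount-degrees G A B =
  trans (pair-count (lookup A) (lookup B) G) (∑∈-comm (lookup A) (lookup B) (λ a b → [ G a b ]))

∑∈-regroup : ∀ {N} (P Q R : Fin N → Bool) (g h : Fin N → Fin N → ℕ) →
  ∑∈ P (λ x → ∑∈ Q (λ y → ∑∈ R (λ z → g x z * h y z))) ≡
  ∑∈ R (λ z → ∑∈ P (λ x → g x z) * ∑∈ Q (λ y → h y z))
∑∈-regroup P Q R g h = begin
  ∑∈ P (λ x → ∑∈ Q (λ y → ∑∈ R (λ z → g x z * h y z)))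
    ≡⟨ ∑∈-cong P (λ x _ → ∑∈-comm Q R (λ y z → g x z * h y z)) ⟩
  ∑∈ P (λ x → ∑∈ R (λ z → ∑∈ Q (λ y → g x z * h y z)))
    ≡⟨ ∑∈-comm P R (λ x z → ∑∈ Q (λ y → g x z * h y z)) ⟩
  ∑∈ R (λ z → ∑∈ P (λ x → ∑∈ Q (λ y → g x z * h y z)))
    ≡⟨ ∑∈-cong R (λ z _ → ∑∈-product P Q (λ x → g x z) (λ y → h y z)) ⟩
  ∑∈ R (λ z → ∑∈ P (λ x → g x z) * ∑∈ Q (λ y → h y z)) ∎
  where open ≡-Reasoning

commonEdges-glue : ∀ {N} (G₁ G₂ : Graph N) (A B : Subset N) (σ τ : Fin N → Fin N) →
  (∀ x → lookup B x ≡ true → lookup A x ≡ false) →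
  commonEdges (glue (lookup A) σ τ) G₁ A B G₂ ≡
  ∑∈ (lookup A) (λ a → ∑∈ (lookup B) (λ b → [ G₁ a b ] * [ G₂ (σ a) (τ b) ]))
commonEdges-glue G₁ G₂ A B σ τ B∩A≡∅ =
  trans (pair-count (lookup A) (lookup B) (λ x y → G₁ x y ∧ G₂ (f x) (f y)))
        (∑∈-cong (lookup A) λ a Aa → ∑∈-cong (lookup B) λ b Bb →
          trans ([∧] (G₁ a b) _)
                (cong₂ (λ u v → [ G₁ a b ] * [ G₂ u v ])
                       (glue-left (lookup A) σ τ Aa) (glue-right (lookup A) σ τ (B∩A≡∅ b Bb))))
  where f = glue (lookup A) σ τ

-- First B₁ is matched to B₂ by τ with weight
-- d₁(b) d₂(b') (degrees into A₁, A₂), whose total is e₁e₂; then A₁ is matched to A₂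
-- by σ with weight W(a,a') = #{b : ab ∈ G₁, a'(τ b) ∈ G₂}, whose total is
-- ∑_b d₁(b) d₂(τ b).
two-rounds : ∀ {N} n₁ n₂ (G₁ G₂ : Graph N) (A₁ B₁ A₂ B₂ : Fin N → Bool) →
  # A₁ ≡ n₁ → # A₂ ≡ n₁ → # B₁ ≡ n₂ → # B₂ ≡ n₂ →
  ∃₂ λ σ τ → BijectiveOn σ A₁ A₂ × BijectiveOn τ B₁ B₂ ×
    ∑∈ B₁ (degree G₁ A₁) * ∑∈ B₂ (degree G₂ A₂) ≤
    n₁ * n₂ * ∑∈ A₁ (λ a → ∑∈ B₁ (λ b → [ G₁ a b ] * [ G₂ (σ a) (τ b) ]))
two-rounds {N} n₁ n₂ G₁ G₂ A₁ B₁ A₂ B₂ #A₁≡ #A₂≡ #B₁≡ #B₂≡ =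
  σ , τ , proj₁ (proj₂ σ-assignment) , proj₁ (proj₂ τ-assignment) , bound
  where
  open ≤-Reasoning
  d₁ d₂ : Fin N → ℕ
  d₁ = degree G₁ A₁
  d₂ = degree G₂ A₂

  τ-assignment : Assignment n₂ B₁ B₂ (λ b b' → d₁ b * d₂ b')
  τ-assignment = assignment n₂ B₁ B₂ #B₁≡ #B₂≡ _
  τ : Fin N → Fin N
  τ = proj₁ τ-assignment

  W : Fin N → Fin N → ℕ
  W a a' = ∑∈ B₁ (λ b → [ G₁ a b ] * [ G₂ a' (τ b) ])
  σ-assignment : Assignment n₁ A₁ A₂ W
  σ-assignment = assignment n₁ A₁ A₂ #A₁≡ #A₂≡ W
  σ : Fin N → Fin N
  σ = proj₁ σ-assignment

  bound : ∑∈ B₁ d₁ * ∑∈ B₂ d₂ ≤ n₁ * n₂ * ∑∈ A₁ (λ a → W a (σ a))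
  bound = begin
    ∑∈ B₁ d₁ * ∑∈ B₂ d₂                         ≡⟨ ∑∈-product B₁ B₂ d₁ d₂ ⟨
    ∑∈ B₁ (λ b → ∑∈ B₂ (λ b' → d₁ b * d₂ b'))  ≤⟨ proj₂ (proj₂ τ-assignment) ⟩
    n₂ * ∑∈ B₁ (λ b → d₁ b * d₂ (τ b))
      ≡⟨ cong (n₂ *_) (∑∈-regroup A₁ A₂ B₁ (λ a b → [ G₁ a b ]) (λ a' b → [ G₂ a' (τ b) ])) ⟨
    n₂ * ∑∈ A₁ (λ a → ∑∈ A₂ (W a))              ≤⟨ *-monoʳ-≤ n₂ (proj₂ (proj₂ σ-assignment)) ⟩
    n₂ * (n₁ * ∑∈ A₁ (λ a → W a (σ a)))         ≡⟨ x∙yz≈y∙xz n₂ n₁ _ ⟩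
    n₁ * (n₂ * ∑∈ A₁ (λ a → W a (σ a)))         ≡⟨ *-assoc n₁ n₂ _ ⟨
    n₁ * n₂ * ∑∈ A₁ (λ a → W a (σ a))           ∎

proposition2p5 : (N n₁ n₂ : ℕ) (G₁ G₂ : Graph N) (A₁ B₁ A₂ B₂ : Subset N) →
    IsBipartite G₁ A₁ B₁ → IsBipartite G₂ A₂ B₂ →
    ∣ A₁ ∣ ≡ n₁ → ∣ A₂ ∣ ≡ n₁ → ∣ B₁ ∣ ≡ n₂ → ∣ B₂ ∣ ≡ n₂ →
    EdgeDisjoint G₁ G₂ →
    DisjointSub (A₁ ∪ A₂) (B₁ ∪ B₂) →
    ISO≥ G₁ A₁ B₁ G₂ A₂ B₂ (edgeCount G₁ A₁ B₁ * edgeCount G₂ A₂ B₂) (n₁ * n₂)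
proposition2p5 N n₁ n₂ G₁ G₂ A₁ B₁ A₂ B₂ (_ , A₁∩B₁≡∅ , _) (_ , A₂∩B₂≡∅ , _)
               |A₁|≡n₁ |A₂|≡n₁ |B₁|≡n₂ |B₂|≡n₂ _ _
  with two-rounds n₁ n₂ G₁ G₂ (lookup A₁) (lookup B₁) (lookup A₂) (lookup B₂)
                  (#-lookup A₁ |A₁|≡n₁) (#-lookup A₂ |A₂|≡n₁) (#-lookup B₁ |B₁|≡n₂) (#-lookup B₂ |B₂|≡n₂)
... | σ , τ , σ-bij , τ-bij , bound =
  glue (lookup A₁) σ τ ,
  bijectionOn (lookup-∪ A₁ B₁) (lookup-∪ A₂ B₂)
    (glue-bijective (disjoint-lookup A₁∩B₁≡∅) (disjoint-lookup A₂∩B₂≡∅) σ-bij τ-bij) ,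
  subst₂ _≤_ (sym (cong₂ _*_ (edgeCount-degrees G₁ A₁ B₁) (edgeCount-degrees G₂ A₂ B₂)))
             (sym (cong (n₁ * n₂ *_) (commonEdges-glue G₁ G₂ A₁ B₁ σ τ (disjoint-lookup A₁∩B₁≡∅))))
             bound
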